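{- Let $X\subset\mathbb{R}^n$ be a finite set, let $f\colon X\to\{ -1,1\}$ and $F\colon\{ -1,1\}^k\to\{ -1,1\}$ be given functions. Then \[\deg_{\pm}(F(f,\dots,f))\geq \deg_{\pm}(F)\,\deg_{\pm}(f).\]
   Context: Boolean functions take values in $\{ -1,1\}$. For a function $h\colon Z\to\{ -1,1\}$ on a finite set $Z\subset\mathbb{R}^m$, the threshold degree $\deg_{\pm}(h)$ is the least (total) degree of a real polynomial $p$ with $h(z)p(z)>0$ for all $z\in Z$. The composition $F(f,\dots,f)$ is the function on $X^k$ given by $(x_1,\dots,x_k)\mapsto F(f(x_1),\dots,f(x_k))$, viewed as a function on a finite subset of $\mathbb{R}^{nk}$. -}

module Defs where

open import Data.Nat using (ℕ; zero; suc) renaming (_+_ to _+ℕ_; _≤_ to _≤ℕ_)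
open import Data.Fin using (Fin; zero; suc; remQuot)
open import Data.Product using (Σ; ∃; _×_; _,_; proj₁; proj₂)
open import Data.Sum using (_⊎_)
open import Data.List using (List; []; _∷_)
open import Data.List.Relation.Unary.All using (All)
open import Data.List.Membership.Propositional using (_∈_)
open import Data.Sign using (Sign)
import Data.Sign as S
open import Relation.Binary.PropositionalEquality using (_≡_; _≢_)
open import Relation.Nullary using (¬_)

-- The real numbers, axiomatised (as usual) as a Dedekind-complete ordered
-- field.  Any two such structures are isomorphic, so quantifying over all
-- of them is the same as speaking about ℝ.
record RealField : Set₁ where
  infixl 6 _+_
  infixl 7 _*_
  infix  4 _<_ _≤_
  field
    R    : Set
    0r 1r : R
    _+_ _*_ : R → R → R
    -_   : R → R
    _<_  : R → R → Set
    +-assoc : ∀ x y z → (x + y) + z ≡ x + (y + z)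
    +-comm  : ∀ x y → x + y ≡ y + x
    +-idˡ   : ∀ x → 0r + x ≡ x
    +-invˡ  : ∀ x → (- x) + x ≡ 0r
    *-assoc : ∀ x y z → (x * y) * z ≡ x * (y * z)
    *-comm  : ∀ x y → x * y ≡ y * x
    *-idˡ   : ∀ x → 1r * x ≡ x
    distribˡ : ∀ x y z → x * (y + z) ≡ x * y + x * z
    0≢1     : 0r ≢ 1r
    *-inv   : ∀ x → x ≢ 0r → ∃ λ y → y * x ≡ 1r
    <-irrefl : ∀ x → ¬ (x < x)
    <-trans  : ∀ x y z → x < y → y < z → x < z
    <-tri    : ∀ x y → x < y ⊎ (x ≡ y ⊎ y < x)
    +-mono-< : ∀ x y z → x < y → x + z < y + z
    *-pos    : ∀ x y → 0r < x → 0r < y → 0r < x * y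
  _≤_ : R → R → Set
  x ≤ y = x < y ⊎ x ≡ y
  field
    sup : (P : R → Set) → ∃ P → (∃ λ b → ∀ x → P x → x ≤ b) →
          ∃ λ s → (∀ x → P x → x ≤ s) × (∀ b → (∀ x → P x → x ≤ b) → s ≤ b)

module _ (ℝ : RealField) where
  open RealField ℝ

  toR : Sign → R
  toR S.+ = 1r
  toR S.- = - 1r

  sumFin : ∀ {m} → (Fin m → ℕ) → ℕ
  sumFin {zero}  e = 0
  sumFin {suc m} e = e zero +ℕ sumFin (λ i → e (suc i))

  pow : R → ℕ → R
  pow x zero    = 1r
  pow x (suc n) = x * pow x n

  monomial : ∀ {m} → (Fin m → ℕ) → (Fin m → R) → R
  monomial {zero}  e x = 1r
  monomial {suc m} e x = pow (x zero) (e zero) * monomial (λ i → e (suc i)) (λ i → x (suc i))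

  Poly : ℕ → Set
  Poly m = List (R × (Fin m → ℕ))

  eval : ∀ {m} → Poly m → (Fin m → R) → R
  eval []            x = 0r
  eval ((c , e) ∷ p) x = c * monomial e x + eval p x

  DegLe : ∀ {m} → Poly m → ℕ → Set
  DegLe p d = All (λ ce → sumFin (proj₂ ce) ≤ℕ d) p

  -- A finite set Z ⊂ ℝ^m is presented as the image of an index type D under ι,
  -- and h : Z → {-1,1} as a function on D.  h is sign-represented by some
  -- polynomial of degree ≤ d.
  SignRep : ∀ {m} {D : Set} → (D → (Fin m → R)) → (D → Sign) → ℕ → Set
  SignRep {m} ι h d = Σ (Poly m) λ p → DegLe p d × (∀ t → 0r < toR (h t) * eval p (ι t))

  IsThrDeg : ∀ {m} {D : Set} → (D → (Fin m → R)) → (D → Sign) → ℕ → Set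
  IsThrDeg ι h d = SignRep ι h d × (∀ d′ → SignRep ι h d′ → d ≤ℕ d′)

  cubeι : ∀ {k} → (Fin k → Sign) → (Fin k → R)
  cubeι s i = toR (s i)

  Elem : ∀ {n} → List (Fin n → R) → Set
  Elem {n} X = Σ (Fin n → R) λ x → x ∈ X

  -- X^k as a subset of ℝ^{k·n} (coordinates of block i, position j at combine i j)
  flatten : ∀ {k n} {X : List (Fin n → R)} → (Fin k → Elem X) → (Fin (k Data.Nat.* n) → R)
  flatten {k} {n} xs a = proj₁ (xs (proj₁ (remQuot {k} n a))) (proj₂ (remQuot {k} n a))

  compose : ∀ {k n} {X : List (Fin n → R)} → ((Fin k → Sign) → Sign) →
            ((Fin n → R) → Sign) → (Fin k → Elem X) → Sign
  compose F f xs = F (λ i → f (proj₁ (xs i)))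

module Submission where

-- The proof is by linear-programming duality.  A function h on a finite set
-- has no sign representation of degree ≤ d exactly when it has a dual
-- witness of degree d: a nonzero nonnegative measure ψ with ∫ ψ h p = 0 for
-- every polynomial p of degree ≤ d.  This equivalence (SignRepDuality) is
-- derived from Gordan's theorem of the alternative, proved here by
-- Fourier–Motzkin elimination.  Given witnesses ψF of degree deg±(F) - 1 for
-- F and ψf of degree deg±(f) - 1 for f, the measure
--   Ψ(x₁, …, xₖ) = Σ_z ψF(z) ∏ᵢ ψf_{zᵢ}(xᵢ),   ψf_s = ψf restricted to f = s,
-- is a witness of degree deg±(F) deg±(f) - 1 for F(f, …, f) (Composition),
-- so F(f, …, f) has no sign representation of smaller degree.

open import Defs
open import Algebra.Bundles using (CommutativeRing)
open import Data.Empty using (⊥-elim)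
open import Data.Nat as ℕ using (ℕ; zero; suc; _∸_; z≤n; s≤s) renaming (_+_ to _+ℕ_; _*_ to _*ℕ_; _≤_ to _≤ℕ_)
import Data.Nat.Properties as ℕ
open import Data.Fin using (Fin; zero; suc; _↑ˡ_; _↑ʳ_; combine)
open import Data.Fin.Properties using (remQuot-combine)
open import Data.Vec.Functional using (tail) renaming (_∷_ to _◂_)
open import Data.Product using (Σ; ∃₂; _×_; _,_; proj₁; proj₂)
open import Data.Sum using (_⊎_; inj₁; inj₂; [_,_]′)
open import Data.List using (List; []; _∷_; _++_; map; concatMap; filter; cartesianProduct; upTo)
open import Data.List.Relation.Unary.Any using (here; there)
open import Data.List.Membership.Propositional using (_∈_; find; lose)
open import Data.List.Membership.Propositional.Properties
  using (∈-map⁺; ∈-map⁻; ∈-++⁺ˡ; ∈-++⁺ʳ; ∈-++⁻; ∈-concatMap⁺; ∈-concatMap⁻; ∈-filter⁺; ∈-filter⁻;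
         ∈-cartesianProduct⁺; ∈-cartesianProduct⁻; ∈-upTo⁺; ∈-upTo⁻)
open import Data.Bool using (Bool; true; false; if_then_else_)
open import Data.Sign using (Sign)
import Data.Sign as Sign
open import Data.Sign.Properties using () renaming (_≟_ to _≟ˢ_)
open import Function using (_∘_)
open import Relation.Binary.PropositionalEquality
import Data.List.Relation.Unary.All as All
open import Relation.Nullary using (¬_; Dec; yes; no)
open import Relation.Nullary.Decidable using (isYes)

module OrderedField (ℝ : RealField) where
  open RealField ℝ public

  +-idʳ : ∀ x → x + 0r ≡ x
  +-idʳ x = trans (+-comm x 0r) (+-idˡ x)

  *-idʳ : ∀ x → x * 1r ≡ x
  *-idʳ x = trans (*-comm x 1r) (*-idˡ x)

  distribʳ : ∀ x y z → (y + z) * x ≡ y * x + z * x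
  distribʳ x y z =
    trans (*-comm (y + z) x) (trans (distribˡ x y z) (cong₂ _+_ (*-comm x y) (*-comm x z)))

  commutativeRing : CommutativeRing _ _
  commutativeRing = record
    { Carrier = R ; _≈_ = _≡_ ; _+_ = _+_ ; _*_ = _*_ ; -_ = -_ ; 0# = 0r ; 1# = 1r
    ; isCommutativeRing = record
      { isRing = record
        { +-isAbelianGroup = record
          { isGroup = record
            { isMonoid = record
              { isSemigroup = record
                { isMagma = record { isEquivalence = isEquivalence ; ∙-cong = cong₂ _+_ }
                ; assoc = +-assoc }
              ; identity = +-idˡ , +-idʳ }
            ; inverse = +-invˡ , (λ x → trans (+-comm x (- x)) (+-invˡ x))
            ; ⁻¹-cong = cong -_ }
          ; comm = +-comm }
        ; *-cong = cong₂ _*_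
        ; *-assoc = *-assoc
        ; *-identity = *-idˡ , *-idʳ
        ; distrib = distribˡ , distribʳ }
      ; *-comm = *-comm } }

  open CommutativeRing commutativeRing public
    using (zeroˡ; zeroʳ; -‿inverseʳ; +-commutativeSemigroup; *-commutativeSemigroup)
  open import Algebra.Properties.Ring (CommutativeRing.ring commutativeRing) public
    using (-‿involutive; -‿distribˡ-*; -‿distribʳ-*; -‿anti-homo-+; -0#≈0#; -1*x≈-x)
    renaming (x∙y⁻¹≈ε⇒x≈y to x-y≡0⇒x≡y)
  open import Algebra.Properties.CommutativeSemigroup +-commutativeSemigroup public
    using () renaming (interchange to +-interchange; x∙yz≈y∙xz to +-left-comm)
  open import Algebra.Properties.CommutativeSemigroup *-commutativeSemigroup public
    using () renaming (x∙yz≈y∙xz to *-left-comm)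

  <⇒≢ : ∀ {x y} → x < y → x ≢ y
  <⇒≢ {x} x<y refl = <-irrefl x x<y

  <-asym : ∀ {x y} → x < y → ¬ (y < x)
  <-asym {x} {y} x<y y<x = <-irrefl x (<-trans x y x x<y y<x)

  <-≤-trans : ∀ {x y z} → x < y → y ≤ z → x < z
  <-≤-trans {x} {y} {z} x<y (inj₁ y<z) = <-trans x y z x<y y<z
  <-≤-trans x<y (inj₂ refl) = x<y

  ≤-<-trans : ∀ {x y z} → x ≤ y → y < z → x < z
  ≤-<-trans {x} {y} {z} (inj₁ x<y) y<z = <-trans x y z x<y y<z
  ≤-<-trans (inj₂ refl) y<z = y<z

  ≤-trans : ∀ {x y z} → x ≤ y → y ≤ z → x ≤ z
  ≤-trans (inj₁ x<y) y≤z = inj₁ (<-≤-trans x<y y≤z)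
  ≤-trans (inj₂ refl) y≤z = y≤z

  _<?_ : ∀ x y → Dec (x < y)
  x <? y with <-tri x y
  ... | inj₁ x<y = yes x<y
  ... | inj₂ (inj₁ refl) = no (<-irrefl x)
  ... | inj₂ (inj₂ y<x) = no (<-asym y<x)

  _≟_ : ∀ x y → Dec (x ≡ y)
  x ≟ y with <-tri x y
  ... | inj₁ x<y = no (<⇒≢ x<y)
  ... | inj₂ (inj₁ x≡y) = yes x≡y
  ... | inj₂ (inj₂ y<x) = no (λ x≡y → <⇒≢ y<x (sym x≡y))

  ≮⇒≥ : ∀ {x y} → ¬ (x < y) → y ≤ x
  ≮⇒≥ {x} {y} x≮y with <-tri x y
  ... | inj₁ x<y = ⊥-elim (x≮y x<y)
  ... | inj₂ (inj₁ refl) = inj₂ refl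
  ... | inj₂ (inj₂ y<x) = inj₁ y<x

  +-monoˡ-< : ∀ z {x y} → x < y → x + z < y + z
  +-monoˡ-< z {x} {y} = +-mono-< x y z

  +-monoʳ-< : ∀ z {x y} → x < y → z + x < z + y
  +-monoʳ-< z {x} {y} x<y = subst₂ _<_ (+-comm x z) (+-comm y z) (+-mono-< x y z x<y)

  +-monoˡ-≤ : ∀ z {x y} → x ≤ y → x + z ≤ y + z
  +-monoˡ-≤ z (inj₁ x<y) = inj₁ (+-monoˡ-< z x<y)
  +-monoˡ-≤ z (inj₂ refl) = inj₂ refl

  x<y⇒0<y-x : ∀ {x y} → x < y → 0r < y + - x
  x<y⇒0<y-x {x} x<y = subst (_< _) (-‿inverseʳ x) (+-monoˡ-< (- x) x<y)

  0<y-x⇒x<y : ∀ {x y} → 0r < y + - x → x < y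
  0<y-x⇒x<y {x} {y} 0<y-x = subst₂ _<_ (+-idˡ x) y-x+x≡y (+-monoˡ-< x 0<y-x)
    where
    y-x+x≡y : (y + - x) + x ≡ y
    y-x+x≡y = trans (+-assoc y (- x) x) (trans (cong (y +_) (+-invˡ x)) (+-idʳ y))

  neg⇒-pos : ∀ {x} → x < 0r → 0r < - x
  neg⇒-pos {x} x<0 = subst (0r <_) (+-idˡ (- x)) (x<y⇒0<y-x x<0)

  -pos⇒neg : ∀ {x} → 0r < - x → x < 0r
  -pos⇒neg {x} 0<-x = 0<y-x⇒x<y (subst (0r <_) (sym (+-idˡ (- x))) 0<-x)

  nn+nn : ∀ {x y} → 0r ≤ x → 0r ≤ y → 0r ≤ x + y
  nn+nn {x} {y} 0≤x 0≤y = ≤-trans 0≤y (subst (_≤ x + y) (+-idˡ y) (+-monoˡ-≤ y 0≤x))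

  pos+nn : ∀ {x y} → 0r < x → 0r ≤ y → 0r < x + y
  pos+nn {x} {y} 0<x 0≤y = <-≤-trans 0<x (subst (_≤ x + y) (+-idʳ x) (lemma 0≤y))
    where
    lemma : 0r ≤ y → x + 0r ≤ x + y
    lemma (inj₁ 0<y) = inj₁ (+-monoʳ-< x 0<y)
    lemma (inj₂ refl) = inj₂ refl

  nn+pos : ∀ {x y} → 0r ≤ x → 0r < y → 0r < x + y
  nn+pos {x} {y} 0≤x 0<y = subst (0r <_) (+-comm y x) (pos+nn 0<y 0≤x)

  +-pos-split : ∀ {x y} → 0r < x + y → 0r < x ⊎ 0r < y
  +-pos-split {x} {y} 0<x+y with 0r <? x | 0r <? y
  ... | yes 0<x | _ = inj₁ 0<x
  ... | no _ | yes 0<y = inj₂ 0<y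
  ... | no 0≮x | no 0≮y = ⊥-elim (<-irrefl 0r (<-≤-trans 0<x+y x+y≤0))
    where
    x+y≤0 : x + y ≤ 0r
    x+y≤0 = ≤-trans (+-monoˡ-≤ y (≮⇒≥ 0≮x)) (subst (_≤ 0r) (sym (+-idˡ y)) (≮⇒≥ 0≮y))

  nn*nn : ∀ {x y} → 0r ≤ x → 0r ≤ y → 0r ≤ x * y
  nn*nn {x} {y} (inj₁ 0<x) (inj₁ 0<y) = inj₁ (*-pos x y 0<x 0<y)
  nn*nn {x} (inj₁ _) (inj₂ refl) = inj₂ (sym (zeroʳ x))
  nn*nn {y = y} (inj₂ refl) _ = inj₂ (sym (zeroˡ y))

  *-monoˡ-< : ∀ {c x y} → 0r < c → x < y → c * x < c * y
  *-monoˡ-< {c} {x} {y} 0<c x<y = 0<y-x⇒x<y (subst (0r <_) c[y-x]≡cy-cx (*-pos c _ 0<c (x<y⇒0<y-x x<y)))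
    where
    c[y-x]≡cy-cx : c * (y + - x) ≡ c * y + - (c * x)
    c[y-x]≡cy-cx = trans (distribˡ c y (- x)) (cong (c * y +_) (sym (-‿distribʳ-* c x)))

  -‿anti-< : ∀ {x y} → x < y → - y < - x
  -‿anti-< {x} {y} x<y = 0<y-x⇒x<y (subst (0r <_) y-x≡-x-[-y] (x<y⇒0<y-x x<y))
    where
    y-x≡-x-[-y] : y + - x ≡ - x + - (- y)
    y-x≡-x-[-y] = trans (+-comm y (- x)) (cong (- x +_) (sym (-‿involutive y)))

  *-monoˡ-<-neg : ∀ {c x y} → c < 0r → x < y → c * y < c * x
  *-monoˡ-<-neg {c} {x} {y} c<0 x<y =
    subst₂ _<_ (neg-neg-c*z y) (neg-neg-c*z x) (-‿anti-< (*-monoˡ-< (neg⇒-pos c<0) x<y))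
    where
    neg-neg-c*z : ∀ z → - (- c * z) ≡ c * z
    neg-neg-c*z z = trans (cong -_ (sym (-‿distribˡ-* c z))) (-‿involutive (c * z))

  -- 1 is positive, since 1 ≢ 0 and squares of negatives are positive.
  0<1 : 0r < 1r
  0<1 with <-tri 0r 1r
  ... | inj₁ 0<1 = 0<1
  ... | inj₂ (inj₁ 0≡1) = ⊥-elim (0≢1 0≡1)
  ... | inj₂ (inj₂ 1<0) = ⊥-elim (<-asym 1<0 (subst (0r <_) -1*-1≡1 (*-pos _ _ (neg⇒-pos 1<0) (neg⇒-pos 1<0))))
    where
    -1*-1≡1 : - 1r * - 1r ≡ 1r
    -1*-1≡1 = trans (-1*x≈-x (- 1r)) (-‿involutive 1r)

  pos*-cancel : ∀ {c x} → 0r < c → 0r < c * x → 0r < x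
  pos*-cancel {c} {x} 0<c 0<cx with <-tri 0r x
  ... | inj₁ 0<x = 0<x
  ... | inj₂ (inj₁ refl) = ⊥-elim (<⇒≢ 0<cx (sym (zeroʳ c)))
  ... | inj₂ (inj₂ x<0) = ⊥-elim (<-asym 0<cx (subst (c * x <_) (zeroʳ c) (*-monoˡ-< 0<c x<0)))

  x<x+1 : ∀ x → x < x + 1r
  x<x+1 x = subst (_< x + 1r) (+-idʳ x) (+-monoʳ-< x 0<1)

  x-1<x : ∀ x → x + - 1r < x
  x-1<x x = subst (x + - 1r <_) x-1+1≡x (x<x+1 (x + - 1r))
    where
    x-1+1≡x : (x + - 1r) + 1r ≡ x
    x-1+1≡x = trans (+-assoc x (- 1r) 1r) (trans (cong (x +_) (+-invˡ 1r)) (+-idʳ x))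

  half : R
  half = proj₁ (*-inv (1r + 1r) (λ 2≡0 → <⇒≢ (pos+nn 0<1 (inj₁ 0<1)) (sym 2≡0)))

  half-double : ∀ x → half * (x + x) ≡ x
  half-double x = begin
    half * (x + x)               ≡⟨ cong (half *_) (sym (trans (distribʳ x 1r 1r) (cong₂ _+_ (*-idˡ x) (*-idˡ x)))) ⟩
    half * ((1r + 1r) * x)       ≡⟨ sym (*-assoc half _ x) ⟩
    (half * (1r + 1r)) * x       ≡⟨ cong (_* x) (proj₂ (*-inv (1r + 1r) _)) ⟩
    1r * x                       ≡⟨ *-idˡ x ⟩
    x                            ∎
    where open ≡-Reasoning

  0<half : 0r < half
  0<half = pos*-cancel (pos+nn 0<1 (inj₁ 0<1))
    (subst (0r <_) (sym (trans (*-comm _ half) (proj₂ (*-inv (1r + 1r) _)))) 0<1)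

  half-sum+half-diff : ∀ P M → half * (P + M) + half * (P + - M) ≡ P
  half-sum+half-diff P M = begin
    half * (P + M) + half * (P + - M)   ≡⟨ sym (distribˡ half _ _) ⟩
    half * ((P + M) + (P + - M))        ≡⟨ cong (half *_) (+-interchange P M P (- M)) ⟩
    half * ((P + P) + (M + - M))        ≡⟨ cong (λ z → half * ((P + P) + z)) (-‿inverseʳ M) ⟩
    half * ((P + P) + 0r)               ≡⟨ cong (half *_) (+-idʳ _) ⟩
    half * (P + P)                      ≡⟨ half-double P ⟩
    P                                   ∎
    where open ≡-Reasoning

  half-sum-half-diff : ∀ P M → half * (P + M) + - (half * (P + - M)) ≡ M
  half-sum-half-diff P M = begin
    half * (P + M) + - (half * (P + - M))   ≡⟨ cong (half * (P + M) +_) (-‿distribʳ-* half _) ⟩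
    half * (P + M) + half * - (P + - M)     ≡⟨ sym (distribˡ half _ _) ⟩
    half * ((P + M) + - (P + - M))          ≡⟨ cong (λ z → half * ((P + M) + z)) (trans (-‿anti-homo-+ P (- M)) (cong (_+ - P) (-‿involutive M))) ⟩
    half * ((P + M) + (M + - P))            ≡⟨ cong (λ z → half * ((P + M) + z)) (+-comm M (- P)) ⟩
    half * ((P + M) + (- P + M))            ≡⟨ cong (half *_) (+-interchange P M (- P) M) ⟩
    half * ((P + - P) + (M + M))            ≡⟨ cong (λ z → half * (z + (M + M))) (-‿inverseʳ P) ⟩
    half * (0r + (M + M))                   ≡⟨ cong (half *_) (+-idˡ _) ⟩
    half * (M + M)                          ≡⟨ half-double M ⟩
    M                                       ∎
    where open ≡-Reasoning

  0<x+x⇒0<x : ∀ {x} → 0r < x + x → 0r < x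
  0<x+x⇒0<x 0<x+x = [ (λ 0<x → 0<x) , (λ 0<x → 0<x) ]′ (+-pos-split 0<x+x)

  midpoint : ∀ {x y} → x < y → Σ R λ m → x < m × m < y
  midpoint {x} {y} x<y =
      half * (x + y)
    , subst (_< half * (x + y)) (half-double x) (*-monoˡ-< 0<half (+-monoʳ-< x x<y))
    , subst (half * (x + y) <_) (half-double y) (*-monoˡ-< 0<half (+-monoˡ-< y x<y))

  lower-bound : ∀ {A : Set} (N : List A) (g : A → R) → Σ R λ ℓ → ∀ q → q ∈ N → ℓ < g q
  lower-bound [] g = 0r , λ _ ()
  lower-bound (q ∷ N) g with lower-bound N g
  ... | ℓ , ℓ<N with ℓ <? g q
  ...   | yes ℓ<gq = ℓ , λ { _ (here refl) → ℓ<gq ; q′ (there q′∈N) → ℓ<N q′ q′∈N }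
  ...   | no ℓ≮gq = g q + - 1r , λ
          { _ (here refl) → x-1<x (g q)
          ; q′ (there q′∈N) → <-trans _ _ _ (x-1<x (g q)) (≤-<-trans (≮⇒≥ ℓ≮gq) (ℓ<N q′ q′∈N)) }

  gap : ∀ {A : Set} ℓ (N : List A) (g : A → R) → (∀ q → q ∈ N → ℓ < g q) →
        Σ R λ τ → ℓ < τ × (∀ q → q ∈ N → τ < g q)
  gap ℓ [] g _ = ℓ + 1r , x<x+1 ℓ , λ _ ()
  gap ℓ (q ∷ N) g ℓ<N with gap ℓ N g (λ q′ q′∈N → ℓ<N q′ (there q′∈N))
  ... | τ , ℓ<τ , τ<N with τ <? g q
  ...   | yes τ<gq = τ , ℓ<τ , λ { _ (here refl) → τ<gq ; q′ (there q′∈N) → τ<N q′ q′∈N }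
  ...   | no τ≮gq with midpoint (ℓ<N q (here refl))
  ...     | m , ℓ<m , m<gq = m , ℓ<m , λ
            { _ (here refl) → m<gq
            ; q′ (there q′∈N) → <-trans _ _ _ m<gq (≤-<-trans (≮⇒≥ τ≮gq) (τ<N q′ q′∈N)) }

  separation : ∀ {A : Set} (P N : List A) (lo hi : A → R) →
               (∀ p q → p ∈ P → q ∈ N → lo p < hi q) →
               Σ R λ τ → (∀ p → p ∈ P → lo p < τ) × (∀ q → q ∈ N → τ < hi q)
  separation [] N lo hi _ = proj₁ (lower-bound N hi) , (λ _ ()) , proj₂ (lower-bound N hi)
  separation (p ∷ P) N lo hi lo<hi with separation P N lo hi (λ p′ q p′∈P → lo<hi p′ q (there p′∈P))
  ... | τ , P<τ , τ<N with lo p <? τ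
  ...   | yes lop<τ = τ , (λ { _ (here refl) → lop<τ ; p′ (there p′∈P) → P<τ p′ p′∈P }) , τ<N
  ...   | no lop≮τ with gap (lo p) N hi (λ q → lo<hi p q (here refl))
  ...     | σ , lop<σ , σ<N = σ , (λ
            { _ (here refl) → lop<σ
            ; p′ (there p′∈P) → <-trans _ _ _ (<-≤-trans (P<τ p′ p′∈P) (≮⇒≥ lop≮τ)) lop<σ }) , σ<N

-- Dual witnesses, products of dual witnesses and the coefficient vectors
-- in Gordan's theorem are all measures, and everything we need about them
-- is linearity, positivity and a Fubini rule for the integral.
module Measures (ℝ : RealField) where
  open OrderedField ℝ

  Measure : Set → Set
  Measure D = List (R × D)

  ∫ : ∀ {D : Set} → Measure D → (D → R) → R
  ∫ [] g = 0r
  ∫ ((w , t) ∷ μ) g = w * g t + ∫ μ g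

  NonNegative : ∀ {D : Set} → Measure D → Set
  NonNegative μ = ∀ {w t} → (w , t) ∈ μ → 0r ≤ w

  SupportedIn : ∀ {D : Set} → List D → Measure D → Set
  SupportedIn L μ = ∀ {w t} → (w , t) ∈ μ → t ∈ L

  HasPositiveAtom : ∀ {D : Set} → Measure D → Set
  HasPositiveAtom μ = ∃₂ λ w t → (w , t) ∈ μ × 0r < w

  ∫-++ : ∀ {D : Set} (μ ν : Measure D) g → ∫ (μ ++ ν) g ≡ ∫ μ g + ∫ ν g
  ∫-++ [] ν g = sym (+-idˡ _)
  ∫-++ ((w , t) ∷ μ) ν g = trans (cong (w * g t +_) (∫-++ μ ν g)) (sym (+-assoc _ _ _))

  ∫-cong : ∀ {D : Set} (μ : Measure D) {g h : D → R} →
           (∀ {w t} → (w , t) ∈ μ → g t ≡ h t) → ∫ μ g ≡ ∫ μ h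
  ∫-cong [] eq = refl
  ∫-cong ((w , t) ∷ μ) eq = cong₂ (λ x y → w * x + y) (eq (here refl)) (∫-cong μ (eq ∘ there))

  ∫-0 : ∀ {D : Set} (μ : Measure D) → ∫ μ (λ _ → 0r) ≡ 0r
  ∫-0 [] = refl
  ∫-0 ((w , t) ∷ μ) = trans (cong₂ _+_ (zeroʳ w) (∫-0 μ)) (+-idˡ 0r)

  ∫-+ : ∀ {D : Set} (μ : Measure D) g h → ∫ μ (λ t → g t + h t) ≡ ∫ μ g + ∫ μ h
  ∫-+ [] g h = sym (+-idˡ 0r)
  ∫-+ ((w , t) ∷ μ) g h =
    trans (cong₂ _+_ (distribˡ w (g t) (h t)) (∫-+ μ g h)) (+-interchange _ _ _ _)

  ∫-* : ∀ {D : Set} (μ : Measure D) c g → ∫ μ (λ t → c * g t) ≡ c * ∫ μ g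
  ∫-* [] c g = sym (zeroʳ c)
  ∫-* ((w , t) ∷ μ) c g =
    trans (cong₂ _+_ (*-left-comm w c (g t)) (∫-* μ c g)) (sym (distribˡ c _ _))

  ∫-nonneg : ∀ {D : Set} (μ : Measure D) {g : D → R} → NonNegative μ →
             (∀ {w t} → (w , t) ∈ μ → 0r ≤ g t) → 0r ≤ ∫ μ g
  ∫-nonneg [] _ _ = inj₂ refl
  ∫-nonneg ((w , t) ∷ μ) μ≥0 g≥0 =
    nn+nn (nn*nn (μ≥0 (here refl)) (g≥0 (here refl))) (∫-nonneg μ (μ≥0 ∘ there) (g≥0 ∘ there))

  ∫-pos : ∀ {D : Set} (μ : Measure D) {g : D → R} → NonNegative μ →
          (∀ {w t} → (w , t) ∈ μ → 0r ≤ g t) →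
          ∀ {w t} → (w , t) ∈ μ → 0r < w → 0r < g t → 0r < ∫ μ g
  ∫-pos ((w , t) ∷ μ) μ≥0 g≥0 (here refl) 0<w 0<gt =
    pos+nn (*-pos _ _ 0<w 0<gt) (∫-nonneg μ (μ≥0 ∘ there) (g≥0 ∘ there))
  ∫-pos ((w , t) ∷ μ) μ≥0 g≥0 (there a∈μ) 0<w 0<gt =
    nn+pos (nn*nn (μ≥0 (here refl)) (g≥0 (here refl))) (∫-pos μ (μ≥0 ∘ there) (g≥0 ∘ there) a∈μ 0<w 0<gt)

  ∫-pos⇒term : ∀ {D : Set} (μ : Measure D) {g : D → R} → 0r < ∫ μ g →
               ∃₂ λ w t → (w , t) ∈ μ × 0r < w * g t
  ∫-pos⇒term [] 0<0 = ⊥-elim (<-irrefl 0r 0<0)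
  ∫-pos⇒term ((w , t) ∷ μ) 0<∫ with +-pos-split 0<∫
  ... | inj₁ 0<wgt = w , t , here refl , 0<wgt
  ... | inj₂ 0<rest = let (w′ , t′ , a∈μ , 0<term) = ∫-pos⇒term μ 0<rest in w′ , t′ , there a∈μ , 0<term

  ∫-swap : ∀ {D E : Set} (μ : Measure D) (ν : Measure E) (G : D → E → R) →
           ∫ μ (λ t → ∫ ν (G t)) ≡ ∫ ν (λ e → ∫ μ (λ t → G t e))
  ∫-swap [] ν G = sym (∫-0 ν)
  ∫-swap ((w , t) ∷ μ) ν G = begin
    w * ∫ ν (G t) + ∫ μ (λ t′ → ∫ ν (G t′))
      ≡⟨ cong₂ _+_ (sym (∫-* ν w (G t))) (∫-swap μ ν G) ⟩
    ∫ ν (λ e → w * G t e) + ∫ ν (λ e → ∫ μ (λ t′ → G t′ e))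
      ≡⟨ sym (∫-+ ν _ _) ⟩
    ∫ ν (λ e → w * G t e + ∫ μ (λ t′ → G t′ e)) ∎
    where open ≡-Reasoning

  positive-mass⇒atom : ∀ {D : Set} (μ : Measure D) → 0r < ∫ μ (λ _ → 1r) → HasPositiveAtom μ
  positive-mass⇒atom μ 0<mass with ∫-pos⇒term μ 0<mass
  ... | w , t , wt∈μ , 0<w*1 = w , t , wt∈μ , subst (0r <_) (*-idʳ w) 0<w*1

  push : ∀ {D E : Set} → (D → E) → Measure D → Measure E
  push φ = map (λ (w , t) → (w , φ t))

  ∫-push : ∀ {D E : Set} (φ : D → E) (μ : Measure D) g → ∫ (push φ μ) g ≡ ∫ μ (g ∘ φ)
  ∫-push φ [] g = refl
  ∫-push φ ((w , t) ∷ μ) g = cong (w * g (φ t) +_) (∫-push φ μ g)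

  ∈-push⁻ : ∀ {D E : Set} (φ : D → E) (μ : Measure D) {w s} → (w , s) ∈ push φ μ →
            Σ D λ t → (w , t) ∈ μ × s ≡ φ t
  ∈-push⁻ φ μ ws∈ with ∈-map⁻ (λ (w , t) → (w , φ t)) ws∈
  ... | (w , t) , wt∈μ , refl = t , wt∈μ , refl

  scale : ∀ {D : Set} → R → Measure D → Measure D
  scale c = map (λ (w , t) → (c * w , t))

  ∫-scale : ∀ {D : Set} c (μ : Measure D) g → ∫ (scale c μ) g ≡ c * ∫ μ g
  ∫-scale c [] g = sym (zeroʳ c)
  ∫-scale c ((w , t) ∷ μ) g =
    trans (cong₂ _+_ (*-assoc c w (g t)) (∫-scale c μ g)) (sym (distribˡ c _ _))

  bind : ∀ {D E : Set} → Measure D → (D → Measure E) → Measure E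
  bind μ κ = concatMap (λ (w , t) → scale w (κ t)) μ

  ∫-bind : ∀ {D E : Set} (μ : Measure D) (κ : D → Measure E) g →
           ∫ (bind μ κ) g ≡ ∫ μ (λ t → ∫ (κ t) g)
  ∫-bind [] κ g = refl
  ∫-bind ((w , t) ∷ μ) κ g =
    trans (∫-++ (scale w (κ t)) (bind μ κ) g) (cong₂ _+_ (∫-scale w (κ t) g) (∫-bind μ κ g))

  ∈-scale⁻ : ∀ {D : Set} c (μ : Measure D) {u s} → (u , s) ∈ scale c μ →
             Σ R λ v → (v , s) ∈ μ × u ≡ c * v
  ∈-scale⁻ c μ u∈ with ∈-map⁻ (λ (w , t) → (c * w , t)) u∈
  ... | (v , s) , v∈μ , refl = v , v∈μ , refl

  ∈-bind⁻ : ∀ {D E : Set} (μ : Measure D) (κ : D → Measure E) {u s} → (u , s) ∈ bind μ κ →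
            ∃₂ λ w t → Σ R λ v → (w , t) ∈ μ × (v , s) ∈ κ t × u ≡ w * v
  ∈-bind⁻ μ κ u∈ with find (∈-concatMap⁻ _ {xs = μ} u∈)
  ... | (w , t) , wt∈μ , u∈κt = let (v , v∈κt , u≡wv) = ∈-scale⁻ w (κ t) u∈κt in w , t , v , wt∈μ , v∈κt , u≡wv

  ∈-bind⁺ : ∀ {D E : Set} (μ : Measure D) (κ : D → Measure E) {w t v s} →
            (w , t) ∈ μ → (v , s) ∈ κ t → (w * v , s) ∈ bind μ κ
  ∈-bind⁺ μ κ {w} wt∈μ vs∈κt = ∈-concatMap⁺ _ (lose wt∈μ (∈-map⁺ (λ (v , s) → (w * v , s)) vs∈κt))

  restrict : ∀ {D : Set} → (D → Sign) → Sign → Measure D → Measure D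
  restrict σ s = filter (λ (w , t) → σ t ≟ˢ s)

  ∈-restrict⁻ : ∀ {D : Set} (σ : D → Sign) s (μ : Measure D) {w t} →
                (w , t) ∈ restrict σ s μ → (w , t) ∈ μ × σ t ≡ s
  ∈-restrict⁻ σ s μ = ∈-filter⁻ (λ (w , t) → σ t ≟ˢ s)

  restrict-nonneg : ∀ {D : Set} (σ : D → Sign) s (μ : Measure D) → NonNegative μ → NonNegative (restrict σ s μ)
  restrict-nonneg σ s μ μ≥0 wt∈ = μ≥0 (proj₁ (∈-restrict⁻ σ s μ wt∈))

  ∫-restrict : ∀ {D : Set} (σ : D → Sign) (μ : Measure D) g →
               ∫ μ g ≡ ∫ (restrict σ Sign.+ μ) g + ∫ (restrict σ Sign.- μ) g
  ∫-restrict σ [] g = sym (+-idˡ 0r)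
  ∫-restrict σ ((w , t) ∷ μ) g with σ t
  ... | Sign.+ = trans (cong (w * g t +_) (∫-restrict σ μ g)) (sym (+-assoc _ _ _))
  ... | Sign.- = trans (cong (w * g t +_) (∫-restrict σ μ g)) (+-left-comm _ _ _)

  ∫-signed : ∀ {D : Set} (σ : D → Sign) (μ : Measure D) g →
             ∫ μ (λ t → toR ℝ (σ t) * g t) ≡ ∫ (restrict σ Sign.+ μ) g + - ∫ (restrict σ Sign.- μ) g
  ∫-signed σ [] g = sym (trans (cong (0r +_) -0#≈0#) (+-idˡ 0r))
  ∫-signed σ ((w , t) ∷ μ) g with σ t
  ... | Sign.+ = trans (cong₂ _+_ (cong (w *_) (*-idˡ (g t))) (∫-signed σ μ g)) (sym (+-assoc _ _ _))
  ... | Sign.- = begin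
    w * (- 1r * g t) + ∫ μ (λ t → toR ℝ (σ t) * g t)
                                   ≡⟨ cong (w * (- 1r * g t) +_) (∫-signed σ μ g) ⟩
    w * (- 1r * g t) + (P + - M)   ≡⟨ cong (_+ (P + - M)) (trans (cong (w *_) (-1*x≈-x (g t))) (sym (-‿distribʳ-* w (g t)))) ⟩
    - (w * g t) + (P + - M)        ≡⟨ +-left-comm _ P _ ⟩
    P + (- (w * g t) + - M)        ≡⟨ cong (P +_) (trans (+-comm _ _) (sym (-‿anti-homo-+ (w * g t) M))) ⟩
    P + - (w * g t + M)            ∎
    where
    open ≡-Reasoning
    P M : R
    P = ∫ (restrict σ Sign.+ μ) g
    M = ∫ (restrict σ Sign.- μ) g

-- The proof is Fourier–Motzkin elimination of one column.
module Gordan (ℝ : RealField) where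
  open OrderedField ℝ
  open Measures ℝ

  Primal : ∀ {C D : Set} → List C → List D → (D → C → R) → Set
  Primal Cs L v = Σ (Measure _) λ c → SupportedIn Cs c × (∀ t → t ∈ L → 0r < ∫ c (v t))

  Dual : ∀ {C D : Set} → List C → List D → (D → C → R) → Set
  Dual Cs L v = Σ (Measure _) λ μ → SupportedIn L μ × NonNegative μ × HasPositiveAtom μ ×
                  (∀ j → j ∈ Cs → ∫ μ (λ t → v t j) ≡ 0r)

  -- Elimination of the column j₀: the rows on which it vanishes are kept,
  -- and every row p where it is positive is paired with every row q where
  -- it is negative into the row (- a q) v_p + (a p) v_q, in which it cancels.
  module Elimination {C D : Set} (Cs : List C) (j₀ : C) (L : List D) (v : D → C → R) where

    a : D → R
    a t = v t j₀

    Pos Zero Neg : List D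
    Pos = filter (λ t → 0r <? a t) L
    Zero = filter (λ t → a t ≟ 0r) L
    Neg = filter (λ t → a t <? 0r) L

    L′ : List (D ⊎ (D × D))
    L′ = map inj₁ Zero ++ map inj₂ (cartesianProduct Pos Neg)

    v′ : D ⊎ (D × D) → C → R
    v′ (inj₁ t) j = v t j
    v′ (inj₂ (p , q)) j = (- a q) * v p j + a p * v q j

    ∈Pos⁻ : ∀ {t} → t ∈ Pos → t ∈ L × 0r < a t
    ∈Pos⁻ = ∈-filter⁻ (λ t → 0r <? a t) {xs = L}

    ∈Neg⁻ : ∀ {t} → t ∈ Neg → t ∈ L × a t < 0r
    ∈Neg⁻ = ∈-filter⁻ (λ t → a t <? 0r) {xs = L}

    Valid : D ⊎ (D × D) → Set
    Valid (inj₁ t) = t ∈ L × a t ≡ 0r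
    Valid (inj₂ (p , q)) = (p ∈ L × 0r < a p) × (q ∈ L × a q < 0r)

    ∈L′⇒Valid : ∀ {t′} → t′ ∈ L′ → Valid t′
    ∈L′⇒Valid t′∈L′ with ∈-++⁻ (map inj₁ Zero) t′∈L′
    ... | inj₁ t′∈Z with ∈-map⁻ inj₁ t′∈Z
    ...   | t , t∈Z , refl = ∈-filter⁻ (λ t → a t ≟ 0r) {xs = L} t∈Z
    ∈L′⇒Valid t′∈L′ | inj₂ t′∈PN with ∈-map⁻ inj₂ t′∈PN
    ...   | (p , q) , pq∈PN , refl =
            let (p∈P , q∈N) = ∈-cartesianProduct⁻ Pos Neg pq∈PN
            in ∈Pos⁻ p∈P , ∈Neg⁻ q∈N

    pair∈L′ : ∀ {p q} → p ∈ Pos → q ∈ Neg → inj₂ (p , q) ∈ L′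
    pair∈L′ p∈P q∈N = ∈-++⁺ʳ (map inj₁ Zero) (∈-map⁺ inj₂ (∈-cartesianProduct⁺ p∈P q∈N))

    -- A solution of the eliminated system extends to the original one: the
    -- coefficient τ of j₀ is chosen strictly between the ratios - r t / a t
    -- bounding it from below (rows with a t > 0) and from above (a t < 0).
    module PrimalLift (c′ : Measure C) (c′⊆Cs : SupportedIn Cs c′)
                      (c′>0 : ∀ t′ → t′ ∈ L′ → 0r < ∫ c′ (v′ t′)) where

      r : D → R
      r t = ∫ c′ (v t)

      ratio : D → R
      ratio t with a t ≟ 0r
      ... | yes _ = 0r
      ... | no a≢0 = - r t * proj₁ (*-inv (a t) a≢0)

      ratio-spec : ∀ t → a t ≢ 0r → a t * ratio t ≡ - r t
      ratio-spec t a≢0 with a t ≟ 0r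
      ... | yes a≡0 = ⊥-elim (a≢0 a≡0)
      ... | no a≢0′ = trans (*-left-comm (a t) (- r t) _)
                        (trans (cong (- r t *_) (trans (*-comm _ _) (proj₂ (*-inv (a t) a≢0′)))) (*-idʳ _))

      r≡-a*ratio : ∀ t → a t ≢ 0r → r t ≡ - (a t * ratio t)
      r≡-a*ratio t a≢0 = trans (sym (-‿involutive (r t))) (cong -_ (sym (ratio-spec t a≢0)))

      -- Positivity on the paired row (p, q) says exactly ratio p < ratio q.
      ratios-separated : ∀ p q → p ∈ Pos → q ∈ Neg → ratio p < ratio q
      ratios-separated p q p∈P q∈N =
        0<y-x⇒x<y (pos*-cancel (*-pos _ _ 0<ap (neg⇒-pos aq<0)) (subst (0r <_) pair-value (c′>0 _ (pair∈L′ p∈P q∈N))))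
        where
        open ≡-Reasoning
        0<ap : 0r < a p
        0<ap = proj₂ (∈Pos⁻ p∈P)
        aq<0 : a q < 0r
        aq<0 = proj₂ (∈Neg⁻ q∈N)
        pair-value : ∫ c′ (v′ (inj₂ (p , q))) ≡ (a p * - a q) * (ratio q + - ratio p)
        pair-value = begin
          ∫ c′ (v′ (inj₂ (p , q)))
            ≡⟨ trans (∫-+ c′ _ _) (cong₂ _+_ (∫-* c′ (- a q) (v p)) (∫-* c′ (a p) (v q))) ⟩
          (- a q) * r p + a p * r q
            ≡⟨ cong₂ (λ x y → (- a q) * x + a p * y)
                 (r≡-a*ratio p (λ ap≡0 → <⇒≢ 0<ap (sym ap≡0))) (r≡-a*ratio q (<⇒≢ aq<0)) ⟩
          (- a q) * - (a p * ratio p) + a p * - (a q * ratio q)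
            ≡⟨ +-comm _ _ ⟩
          a p * - (a q * ratio q) + (- a q) * - (a p * ratio p)
            ≡⟨ cong₂ _+_
                 (trans (cong (a p *_) (-‿distribˡ-* (a q) (ratio q))) (sym (*-assoc _ _ _)))
                 (trans (cong ((- a q) *_) (-‿distribʳ-* (a p) (ratio p)))
                   (trans (sym (*-assoc _ _ _)) (cong (_* - ratio p) (*-comm (- a q) (a p))))) ⟩
          (a p * - a q) * ratio q + (a p * - a q) * - ratio p
            ≡⟨ sym (distribˡ _ _ _) ⟩
          (a p * - a q) * (ratio q + - ratio p) ∎

      τ : R
      τ = proj₁ (separation Pos Neg ratio ratio ratios-separated)

      ratio<τ : ∀ p → p ∈ Pos → ratio p < τ
      ratio<τ = proj₁ (proj₂ (separation Pos Neg ratio ratio ratios-separated))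

      τ<ratio : ∀ q → q ∈ Neg → τ < ratio q
      τ<ratio = proj₂ (proj₂ (separation Pos Neg ratio ratio ratios-separated))

      beyond-ratio : ∀ t → a t ≢ 0r → a t * ratio t < a t * τ → 0r < τ * a t + r t
      beyond-ratio t a≢0 lt = subst (0r <_) (cong₂ _+_ (*-comm (a t) τ) (-‿involutive (r t)))
        (x<y⇒0<y-x (subst (_< a t * τ) (ratio-spec t a≢0) lt))

      extended-positive : ∀ t → t ∈ L → 0r < τ * a t + r t
      extended-positive t t∈L with <-tri 0r (a t)
      ... | inj₁ 0<a = beyond-ratio t (λ a≡0 → <⇒≢ 0<a (sym a≡0))
                         (*-monoˡ-< 0<a (ratio<τ t (∈-filter⁺ (λ t → 0r <? a t) t∈L 0<a)))
      ... | inj₂ (inj₂ a<0) = beyond-ratio t (<⇒≢ a<0)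
                                (*-monoˡ-<-neg a<0 (τ<ratio t (∈-filter⁺ (λ t → a t <? 0r) t∈L a<0)))
      ... | inj₂ (inj₁ 0≡a) = subst (0r <_) (sym (trans (cong (λ x → τ * x + r t) (sym 0≡a)) (trans (cong (_+ r t) (zeroʳ τ)) (+-idˡ (r t)))))
                                (c′>0 (inj₁ t) (∈-++⁺ˡ (∈-map⁺ inj₁ (∈-filter⁺ (λ t → a t ≟ 0r) t∈L (sym 0≡a)))))

      lift : Primal (j₀ ∷ Cs) L v
      lift = (τ , j₀) ∷ c′ , (λ { (here refl) → here refl ; (there m) → there (c′⊆Cs m) }) , extended-positive

    -- A dual solution for the eliminated system is pulled back by splitting
    -- each paired row (p , q) into its two parents with weights - a q and a p.
    module DualLift (μ′ : Measure (D ⊎ (D × D))) (μ′⊆L′ : SupportedIn L′ μ′) (μ′≥0 : NonNegative μ′)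
                    (μ′+ : HasPositiveAtom μ′) (μ′⊥ : ∀ j → j ∈ Cs → ∫ μ′ (λ t′ → v′ t′ j) ≡ 0r) where

      split : D ⊎ (D × D) → Measure D
      split (inj₁ t) = (1r , t) ∷ []
      split (inj₂ (p , q)) = (- a q , p) ∷ (a p , q) ∷ []

      μ : Measure D
      μ = bind μ′ split

      ∫-split : ∀ t′ j → ∫ (split t′) (λ t → v t j) ≡ v′ t′ j
      ∫-split (inj₁ t) j = trans (+-idʳ _) (*-idˡ _)
      ∫-split (inj₂ (p , q)) j = cong ((- a q) * v p j +_) (+-idʳ _)

      ∫-split-a : ∀ {t′} → Valid t′ → ∫ (split t′) a ≡ 0r
      ∫-split-a {inj₁ t} (_ , at≡0) = trans (∫-split (inj₁ t) j₀) at≡0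
      ∫-split-a {inj₂ (p , q)} _ = trans (∫-split (inj₂ (p , q)) j₀)
        (trans (cong₂ _+_ (sym (-‿distribˡ-* (a q) (a p))) (*-comm (a p) (a q))) (+-invˡ _))

      split-atoms : ∀ {t′ w s} → Valid t′ → (w , s) ∈ split t′ → s ∈ L × 0r < w
      split-atoms {inj₁ t} (t∈L , _) (here refl) = t∈L , 0<1
      split-atoms {inj₂ (p , q)} ((p∈L , _) , (_ , aq<0)) (here refl) = p∈L , neg⇒-pos aq<0
      split-atoms {inj₂ (p , q)} ((_ , 0<ap) , (q∈L , _)) (there (here refl)) = q∈L , 0<ap

      split-head : ∀ t′ → ∃₂ λ w s → (w , s) ∈ split t′
      split-head (inj₁ t) = 1r , t , here refl
      split-head (inj₂ (p , q)) = - a q , p , here refl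

      atoms-of-μ : ∀ {u s} → (u , s) ∈ μ → s ∈ L × 0r ≤ u
      atoms-of-μ us∈μ with ∈-bind⁻ μ′ split us∈μ
      ... | w , t′ , x , wt′∈μ′ , xs∈split , refl =
            let (s∈L , 0<x) = split-atoms (∈L′⇒Valid (μ′⊆L′ wt′∈μ′)) xs∈split
            in s∈L , nn*nn (μ′≥0 wt′∈μ′) (inj₁ 0<x)

      positive-atom : HasPositiveAtom μ
      positive-atom =
        let (w , t′ , wt′∈μ′ , 0<w) = μ′+
            (x , s , xs∈split) = split-head t′
        in w * x , s , ∈-bind⁺ μ′ split wt′∈μ′ xs∈split ,
           *-pos w x 0<w (proj₂ (split-atoms (∈L′⇒Valid (μ′⊆L′ wt′∈μ′)) xs∈split))

      orthogonal : ∀ j → j ∈ j₀ ∷ Cs → ∫ μ (λ t → v t j) ≡ 0r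
      orthogonal _ (here refl) = trans (∫-bind μ′ split a)
        (trans (∫-cong μ′ (λ wt′∈μ′ → ∫-split-a (∈L′⇒Valid (μ′⊆L′ wt′∈μ′)))) (∫-0 μ′))
      orthogonal j (there j∈Cs) = trans (∫-bind μ′ split _)
        (trans (∫-cong μ′ (λ {_} {t′} _ → ∫-split t′ j)) (μ′⊥ j j∈Cs))

      lift : Dual (j₀ ∷ Cs) L v
      lift = μ , proj₁ ∘ atoms-of-μ , proj₂ ∘ atoms-of-μ , positive-atom , orthogonal

  -- Induction on the columns.  Without columns, the empty combination is
  -- primal if there are no rows and any single row is dual otherwise.
  gordan : ∀ {C D : Set} (Cs : List C) (L : List D) (v : D → C → R) → Primal Cs L v ⊎ Dual Cs L v
  gordan [] [] v = inj₁ ([] , (λ ()) , λ _ ())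
  gordan [] (t ∷ L) v = inj₂ ((1r , t) ∷ [] , (λ { (here refl) → here refl }) ,
    (λ { (here refl) → inj₁ 0<1 }) , (1r , t , here refl , 0<1) , λ _ ())
  gordan (j₀ ∷ Cs) L v with gordan Cs (Elimination.L′ Cs j₀ L v) (Elimination.v′ Cs j₀ L v)
  ... | inj₁ (c′ , c′⊆Cs , c′>0) = inj₁ (Elimination.PrimalLift.lift Cs j₀ L v c′ c′⊆Cs c′>0)
  ... | inj₂ (μ′ , μ′⊆L′ , μ′≥0 , μ′+ , μ′⊥) = inj₂ (Elimination.DualLift.lift Cs j₀ L v μ′ μ′⊆L′ μ′≥0 μ′+ μ′⊥)

-- Polynomials are measures on exponent vectors: evaluating one integrates
-- the monomials against it.  The monomials of degree ≤ d form a finite list,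
-- which is what makes the linear-programming duality applicable.
module Polynomials (ℝ : RealField) where
  open OrderedField ℝ
  open Measures ℝ

  degree : ∀ {m} → (Fin m → ℕ) → ℕ
  degree = sumFin ℝ

  eval-∫ : ∀ {m} (p : Poly ℝ m) x → eval ℝ p x ≡ ∫ p (λ e → monomial ℝ e x)
  eval-∫ [] x = refl
  eval-∫ ((c , e) ∷ p) x = cong (c * monomial ℝ e x +_) (eval-∫ p x)

  monomial-cong : ∀ {m} {e e′ : Fin m → ℕ} {x x′ : Fin m → R} →
                  (∀ i → e i ≡ e′ i) → (∀ i → x i ≡ x′ i) → monomial ℝ e x ≡ monomial ℝ e′ x′
  monomial-cong {zero} _ _ = refl
  monomial-cong {suc m} e≗e′ x≗x′ =
    cong₂ _*_ (cong₂ (pow ℝ) (x≗x′ zero) (e≗e′ zero)) (monomial-cong (e≗e′ ∘ suc) (x≗x′ ∘ suc))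

  eval-cong : ∀ {m} (p : Poly ℝ m) {x x′ : Fin m → R} → (∀ i → x i ≡ x′ i) → eval ℝ p x ≡ eval ℝ p x′
  eval-cong p {x} {x′} x≗x′ = trans (eval-∫ p x)
    (trans (∫-cong p (λ _ → monomial-cong (λ _ → refl) x≗x′)) (sym (eval-∫ p x′)))

  monomial-1 : ∀ {m} (x : Fin m → R) → monomial ℝ (λ _ → 0) x ≡ 1r
  monomial-1 {zero} x = refl
  monomial-1 {suc m} x = trans (*-idˡ _) (monomial-1 (tail x))

  degree-1 : ∀ m → degree {m} (λ _ → 0) ≡ 0
  degree-1 zero = refl
  degree-1 (suc m) = degree-1 m

  degree-mono : ∀ {m} {e e′ : Fin m → ℕ} → (∀ i → e i ≤ℕ e′ i) → degree e ≤ℕ degree e′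
  degree-mono {zero} _ = z≤n
  degree-mono {suc m} e≤e′ = ℕ.+-mono-≤ (e≤e′ zero) (degree-mono (e≤e′ ∘ suc))

  exponents : (m d : ℕ) → List (Fin m → ℕ)
  exponents zero d = (λ ()) ∷ []
  exponents (suc m) d = concatMap (λ a → map (a ◂_) (exponents m (d ∸ a))) (upTo (suc d))

  exponents-degree : ∀ m d {e} → e ∈ exponents m d → degree e ≤ℕ d
  exponents-degree zero d (here refl) = z≤n
  exponents-degree (suc m) d e∈ with find (∈-concatMap⁻ (λ a → map (a ◂_) (exponents m (d ∸ a))) {xs = upTo (suc d)} e∈)
  ... | a , a∈ , e∈a with ∈-map⁻ (a ◂_) e∈a
  ...   | e′ , e′∈ , refl = ℕ.≤-trans (ℕ.+-monoʳ-≤ a (exponents-degree m (d ∸ a) e′∈))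
                             (ℕ.≤-reflexive (ℕ.m+[n∸m]≡n (ℕ.≤-pred (∈-upTo⁻ a∈))))

  exponents-complete : ∀ m d (e : Fin m → ℕ) → degree e ≤ℕ d →
                       Σ (Fin m → ℕ) λ e′ → e′ ∈ exponents m d × (∀ i → e i ≡ e′ i)
  exponents-complete zero d e _ = (λ ()) , here refl , λ ()
  exponents-complete (suc m) d e deg≤d
    with exponents-complete m (d ∸ e zero) (tail e)
           (ℕ.m+n≤o⇒m≤o∸n (degree (tail e)) (subst (_≤ℕ d) (ℕ.+-comm (e zero) _) deg≤d))
  ... | e′ , e′∈ , tail≗ =
        e zero ◂ e′
      , ∈-concatMap⁺ _ (lose (∈-upTo⁺ (s≤s (ℕ.m+n≤o⇒m≤o (e zero) deg≤d))) (∈-map⁺ (e zero ◂_) e′∈))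
      , λ { zero → refl ; (suc i) → tail≗ i }

module SignRepDuality (ℝ : RealField) where
  open OrderedField ℝ
  open Measures ℝ
  open Polynomials ℝ
  open Gordan ℝ

  Orthogonal : ∀ {m} {D : Set} → (D → Fin m → R) → (D → Sign) → ℕ → Measure D → Set
  Orthogonal ι h d ψ = ∀ e → degree e ≤ℕ d → ∫ ψ (λ t → toR ℝ (h t) * monomial ℝ e (ι t)) ≡ 0r

  DualWitness : ∀ {m} {D : Set} → (D → Fin m → R) → (D → Sign) → ℕ → Measure D → Set
  DualWitness ι h d ψ = NonNegative ψ × HasPositiveAtom ψ × Orthogonal ι h d ψ

  orthogonal-poly : ∀ {m} {D : Set} (ι : D → Fin m → R) h d (ψ : Measure D) → Orthogonal ι h d ψ →
                    ∀ p → All.All (λ (_ , e) → degree e ≤ℕ d) p →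
                    ∫ ψ (λ t → toR ℝ (h t) * eval ℝ p (ι t)) ≡ 0r
  orthogonal-poly ι h d ψ ψ⊥ p p≤d = begin
    ∫ ψ (λ t → toR ℝ (h t) * eval ℝ p (ι t))
      ≡⟨ ∫-cong ψ (λ {_} {t} _ → trans (cong (toR ℝ (h t) *_) (eval-∫ p (ι t))) (sym (∫-* p _ _))) ⟩
    ∫ ψ (λ t → ∫ p (λ e → toR ℝ (h t) * monomial ℝ e (ι t)))
      ≡⟨ ∫-swap ψ p _ ⟩
    ∫ p (λ e → ∫ ψ (λ t → toR ℝ (h t) * monomial ℝ e (ι t)))
      ≡⟨ ∫-cong p (λ {_} {e} ce∈p → ψ⊥ e (All.lookup p≤d ce∈p)) ⟩
    ∫ p (λ _ → 0r)
      ≡⟨ ∫-0 p ⟩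
    0r ∎
    where open ≡-Reasoning

  -- Weak duality: a dual witness of degree d rules out sign representations
  -- of degree ≤ d, since the witness integrates h · p to a positive number.
  witness⇒¬SignRep : ∀ {m} {D : Set} (ι : D → Fin m → R) h d (ψ : Measure D) → DualWitness ι h d ψ →
                     ∀ {d′} → d′ ≤ℕ d → ¬ SignRep ℝ ι h d′
  witness⇒¬SignRep ι h d ψ (ψ≥0 , (w , t , wt∈ψ , 0<w) , ψ⊥) d′≤d (p , p≤d′ , p-represents) =
    <⇒≢ (∫-pos ψ ψ≥0 (λ {_} {t} _ → inj₁ (p-represents t)) wt∈ψ 0<w (p-represents t))
        (sym (orthogonal-poly ι h d ψ ψ⊥ p (All.map (λ le → ℕ.≤-trans le d′≤d) p≤d′)))

  SignRep⇒determined : ∀ {m} {D : Set} (ι : D → Fin m → R) h d → SignRep ℝ ι h d →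
                       ∀ t t′ → (∀ i → ι t i ≡ ι t′ i) → h t ≡ h t′
  SignRep⇒determined ι h d (p , _ , p-represents) t t′ ι≗ =
    same-sign (h t) (h t′) (p-represents t) (subst (λ y → 0r < toR ℝ (h t′) * y) (sym (eval-cong p ι≗)) (p-represents t′))
    where
    y : R
    y = eval ℝ p (ι t)
    same-sign : ∀ s s′ → 0r < toR ℝ s * y → 0r < toR ℝ s′ * y → s ≡ s′
    same-sign Sign.+ Sign.+ _ _ = refl
    same-sign Sign.- Sign.- _ _ = refl
    same-sign Sign.+ Sign.- 0<y 0<-y = ⊥-elim (<-asym (subst (0r <_) (*-idˡ y) 0<y) (-pos⇒neg (subst (0r <_) (-1*x≈-x y) 0<-y)))
    same-sign Sign.- Sign.+ 0<-y 0<y = ⊥-elim (<-asym (subst (0r <_) (*-idˡ y) 0<y) (-pos⇒neg (subst (0r <_) (-1*x≈-x y) 0<-y)))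

  -- The domain must be covered, up to the values of h and
  -- ι, by a finite list L; Gordan's theorem is applied to the matrix with
  -- rows L and columns the monomials of degree ≤ d.
  ¬SignRep⇒witness : ∀ {m} {D : Set} (ι : D → Fin m → R) h d (L : List D) →
    (∀ t → Σ D λ t′ → t′ ∈ L × h t ≡ h t′ × (∀ i → ι t i ≡ ι t′ i)) →
    ¬ SignRep ℝ ι h d → Σ (Measure D) (DualWitness ι h d)
  ¬SignRep⇒witness {m} ι h d L cover ¬rep with gordan (exponents m d) L (λ t e → toR ℝ (h t) * monomial ℝ e (ι t))
  ... | inj₁ (c , c⊆exponents , c>0) =
        ⊥-elim (¬rep (c , All.tabulate (λ ce∈c → exponents-degree m d (c⊆exponents ce∈c)) , c-represents))
    where
    c-represents : ∀ t → 0r < toR ℝ (h t) * eval ℝ c (ι t)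
    c-represents t with cover t
    ... | t′ , t′∈L , h≡ , ι≗ = subst (0r <_)
          (sym (trans (cong₂ (λ s y → toR ℝ s * y) h≡ (trans (eval-cong c ι≗) (eval-∫ c (ι t′)))) (sym (∫-* c _ _))))
          (c>0 t′ t′∈L)
  ... | inj₂ (ψ , _ , ψ≥0 , ψ+ , ψ⊥) = ψ , ψ≥0 , ψ+ , λ e deg≤d →
        let (e′ , e′∈ , e≗e′) = exponents-complete m d e deg≤d
        in trans (∫-cong ψ (λ _ → cong (_ *_) (monomial-cong e≗e′ (λ _ → refl)))) (ψ⊥ e′ e′∈)

  threshold⇒witness : ∀ {m} {D : Set} (ι : D → Fin m → R) h d (L : List D) →
    (∀ t → Σ D λ t′ → t′ ∈ L × h t ≡ h t′ × (∀ i → ι t i ≡ ι t′ i)) →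
    IsThrDeg ℝ ι h (suc d) → Σ (Measure D) (DualWitness ι h d)
  threshold⇒witness ι h d L cover (_ , minimal) =
    ¬SignRep⇒witness ι h d L cover (λ rep → ℕ.<-irrefl refl (minimal d rep))

module ProductMeasure (ℝ : RealField) where
  open OrderedField ℝ
  open Measures ℝ
  open import Algebra.Properties.Monoid.Sum (CommutativeRing.*-monoid commutativeRing) public
    using () renaming (sum to ∏; sum-cong-≗ to ∏-cong)

  product : ∀ {k} {E : Set} → (Fin k → Measure E) → Measure (Fin k → E)
  product {zero} μs = (1r , λ ()) ∷ []
  product {suc k} μs = bind (μs zero) (λ x → push (x ◂_) (product (tail μs)))

  ∫-product : ∀ {k} {E : Set} (μs : Fin k → Measure E) (g : Fin k → E → R) →
              ∫ (product μs) (λ xs → ∏ (λ i → g i (xs i))) ≡ ∏ (λ i → ∫ (μs i) (g i))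
  ∫-product {zero} μs g = trans (+-idʳ _) (*-idˡ 1r)
  ∫-product {suc k} μs g = begin
    ∫ (product μs) (λ xs → ∏ (λ i → g i (xs i)))
      ≡⟨ ∫-bind (μs zero) _ _ ⟩
    ∫ (μs zero) (λ x → ∫ (push (x ◂_) (product (tail μs))) (λ xs → ∏ (λ i → g i (xs i))))
      ≡⟨ ∫-cong (μs zero) (λ {_} {x} _ → trans (∫-push (x ◂_) (product (tail μs)) _) (∫-* (product (tail μs)) (g zero x) _)) ⟩
    ∫ (μs zero) (λ x → g zero x * ∫ (product (tail μs)) (λ xs → ∏ (λ i → g (suc i) (xs i))))
      ≡⟨ ∫-cong (μs zero) (λ _ → *-comm _ _) ⟩
    ∫ (μs zero) (λ x → ∫ (product (tail μs)) (λ xs → ∏ (λ i → g (suc i) (xs i))) * g zero x)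
      ≡⟨ trans (∫-* (μs zero) _ (g zero)) (*-comm _ _) ⟩
    ∫ (μs zero) (g zero) * ∫ (product (tail μs)) (λ xs → ∏ (λ i → g (suc i) (xs i)))
      ≡⟨ cong (∫ (μs zero) (g zero) *_) (∫-product (tail μs) (tail g)) ⟩
    ∏ (λ i → ∫ (μs i) (g i)) ∎
    where open ≡-Reasoning

  product-points : ∀ {k} {E : Set} (μs : Fin k → Measure E) {w xs} → (w , xs) ∈ product μs →
                   ∀ i → Σ R λ wᵢ → (wᵢ , xs i) ∈ μs i
  product-points {suc k} μs ws∈ i with ∈-bind⁻ (μs zero) _ ws∈
  ... | w₀ , x , v , wx∈μ₀ , vs∈push , _ with ∈-push⁻ (x ◂_) (product (tail μs)) vs∈push
  ...   | r , vr∈ , refl with i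
  ...     | zero = w₀ , wx∈μ₀
  ...     | suc i′ = product-points (tail μs) vr∈ i′

  product-nonneg : ∀ {k} {E : Set} (μs : Fin k → Measure E) → (∀ i → NonNegative (μs i)) →
                   NonNegative (product μs)
  product-nonneg {zero} μs _ (here refl) = inj₁ 0<1
  product-nonneg {suc k} μs μs≥0 ws∈ with ∈-bind⁻ (μs zero) _ ws∈
  ... | w₀ , x , v , wx∈μ₀ , vs∈push , refl with ∈-push⁻ (x ◂_) (product (tail μs)) vs∈push
  ...   | r , vr∈ , refl = nn*nn (μs≥0 zero wx∈μ₀) (product-nonneg (tail μs) (μs≥0 ∘ suc) vr∈)

  product-positive : ∀ {k} {E : Set} (μs : Fin k → Measure E) → (∀ i → HasPositiveAtom (μs i)) →
                     HasPositiveAtom (product μs)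
  product-positive {zero} μs _ = 1r , (λ ()) , here refl , 0<1
  product-positive {suc k} μs μs+ =
    let (w₀ , x , wx∈μ₀ , 0<w₀) = μs+ zero
        (v , r , vr∈ , 0<v) = product-positive (tail μs) (μs+ ∘ suc)
    in w₀ * v , x ◂ r , ∈-bind⁺ (μs zero) _ wx∈μ₀ (∈-map⁺ (λ (w , t) → (w , x ◂ t)) vr∈) , *-pos _ _ 0<w₀ 0<v

module Blocks (ℝ : RealField) where
  open OrderedField ℝ
  open Polynomials ℝ
  open ProductMeasure ℝ

  monomial-++ : ∀ a b (e : Fin (a +ℕ b) → ℕ) (x : Fin (a +ℕ b) → R) →
                monomial ℝ e x ≡ monomial ℝ (λ j → e (j ↑ˡ b)) (λ j → x (j ↑ˡ b)) * monomial ℝ (λ j → e (a ↑ʳ j)) (λ j → x (a ↑ʳ j))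
  monomial-++ zero b e x = sym (*-idˡ _)
  monomial-++ (suc a) b e x = trans (cong (pow ℝ (x zero) (e zero) *_) (monomial-++ a b (tail e) (tail x))) (sym (*-assoc _ _ _))

  degree-++ : ∀ a b (e : Fin (a +ℕ b) → ℕ) → degree e ≡ degree (λ j → e (j ↑ˡ b)) +ℕ degree (λ j → e (a ↑ʳ j))
  degree-++ zero b e = refl
  degree-++ (suc a) b e = trans (cong (e zero +ℕ_) (degree-++ a b (tail e))) (sym (ℕ.+-assoc (e zero) _ _))

  block : ∀ {k n} {A : Set} → (Fin (k *ℕ n) → A) → Fin k → Fin n → A
  block e i j = e (combine i j)

  monomial-blocks : ∀ {k n} (e : Fin (k *ℕ n) → ℕ) (x : Fin (k *ℕ n) → R) →
                    monomial ℝ e x ≡ ∏ (λ i → monomial ℝ (block {k} {n} e i) (block {k} {n} x i))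
  monomial-blocks {zero} e x = refl
  monomial-blocks {suc k} {n} e x =
    trans (monomial-++ n (k *ℕ n) e x)
          (cong (monomial ℝ (block {suc k} {n} e zero) (block {suc k} {n} x zero) *_)
                (monomial-blocks {k} (λ a → e (n ↑ʳ a)) (λ a → x (n ↑ʳ a))))

  degree-blocks : ∀ {k n} (e : Fin (k *ℕ n) → ℕ) → degree e ≡ sumFin ℝ (λ i → degree (block {k} {n} e i))
  degree-blocks {zero} e = refl
  degree-blocks {suc k} {n} e =
    trans (degree-++ n (k *ℕ n) e) (cong (degree (block {suc k} {n} e zero) +ℕ_) (degree-blocks {k} (λ a → e (n ↑ʳ a))))

  block-flatten : ∀ {k n} {X : List (Fin n → R)} (xs : Fin k → Elem ℝ X) i j →
                  block {k} {n} (flatten ℝ {k} {n} {X} xs) i j ≡ proj₁ (xs i) j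
  block-flatten {k} {n} xs i j = cong (λ (i′ , j′) → proj₁ (xs i′) j′) (remQuot-combine {k} {n} i j)

  monomial-flatten : ∀ {k n} {X : List (Fin n → R)} (e : Fin (k *ℕ n) → ℕ) (xs : Fin k → Elem ℝ X) →
                     monomial ℝ e (flatten ℝ {k} {n} {X} xs) ≡ ∏ (λ i → monomial ℝ (block {k} {n} e i) (proj₁ (xs i)))
  monomial-flatten {k} {n} e xs = trans (monomial-blocks {k} {n} e _)
    (∏-cong (λ i → monomial-cong (λ _ → refl) (block-flatten xs i)))

module AffineProduct (ℝ : RealField) where
  open OrderedField ℝ
  open Measures ℝ
  open Polynomials ℝ
  open ProductMeasure ℝ

  affine : Bool → R → R → R → R
  affine true u v y = u + v * y
  affine false u v y = u

  indicator : ∀ {k} → (Fin k → Bool) → Fin k → ℕ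
  indicator b i = if b i then 1 else 0

  shift : ∀ {k} → R → ℕ → Poly ℝ k → Poly ℝ (suc k)
  shift c a q = scale c (push (a ◂_) q)

  ∫-shift : ∀ {k} c a (q : Poly ℝ k) (y : Fin (suc k) → R) →
            ∫ (shift c a q) (λ e → monomial ℝ e y) ≡ c * (pow ℝ (y zero) a * ∫ q (λ e → monomial ℝ e (tail y)))
  ∫-shift c a q y = trans (∫-scale c (push (a ◂_) q) (λ e → monomial ℝ e y))
    (cong (c *_) (trans (∫-push (a ◂_) q _) (∫-* q (pow ℝ (y zero) a) (λ e → monomial ℝ e (tail y)))))

  ∈-shift⁻ : ∀ {k} c a (q : Poly ℝ k) {w e} → (w , e) ∈ shift c a q →
             Σ (Fin k → ℕ) λ e′ → Σ R (λ w′ → (w′ , e′) ∈ q) × e ≡ a ◂ e′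
  ∈-shift⁻ c a q we∈ with ∈-scale⁻ c (push (a ◂_) q) we∈
  ... | w′ , we∈push , _ with ∈-push⁻ (a ◂_) q we∈push
  ...   | e′ , we′∈q , refl = e′ , (w′ , we′∈q) , refl

  affineFactor : ∀ {k} → Bool → R → R → Poly ℝ k → Poly ℝ (suc k)
  affineFactor true u v q = shift u 0 q ++ shift v 1 q
  affineFactor false u v q = shift u 0 q

  affineProduct : ∀ {k} → (Fin k → Bool) → (Fin k → R) → (Fin k → R) → Poly ℝ k
  affineProduct {zero} b u v = (1r , λ ()) ∷ []
  affineProduct {suc k} b u v = affineFactor (b zero) (u zero) (v zero) (affineProduct (tail b) (tail u) (tail v))

  ∫-affineFactor : ∀ {k} β u v (q : Poly ℝ k) (y : Fin (suc k) → R) →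
                   ∫ (affineFactor β u v q) (λ e → monomial ℝ e y) ≡ affine β u v (y zero) * ∫ q (λ e → monomial ℝ e (tail y))
  ∫-affineFactor true u v q y = begin
    ∫ (shift u 0 q ++ shift v 1 q) (λ e → monomial ℝ e y)
      ≡⟨ trans (∫-++ (shift u 0 q) _ _) (cong₂ _+_ (∫-shift u 0 q y) (∫-shift v 1 q y)) ⟩
    u * (1r * I) + v * ((y zero * 1r) * I)
      ≡⟨ cong₂ _+_ (cong (u *_) (*-idˡ I)) (trans (cong (λ z → v * (z * I)) (*-idʳ (y zero))) (sym (*-assoc v _ I))) ⟩
    u * I + (v * y zero) * I
      ≡⟨ sym (distribʳ I u _) ⟩
    (u + v * y zero) * I ∎
    where
    open ≡-Reasoning
    I : R
    I = ∫ q (λ e → monomial ℝ e (tail y))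
  ∫-affineFactor false u v q y = trans (∫-shift u 0 q y) (cong (u *_) (*-idˡ _))

  eval-affineProduct : ∀ {k} b u v (y : Fin k → R) →
                       eval ℝ (affineProduct b u v) y ≡ ∏ (λ i → affine (b i) (u i) (v i) (y i))
  eval-affineProduct {zero} b u v y = trans (+-idʳ _) (*-idˡ 1r)
  eval-affineProduct {suc k} b u v y = begin
    eval ℝ (affineProduct b u v) y
      ≡⟨ eval-∫ (affineProduct b u v) y ⟩
    ∫ (affineProduct b u v) (λ e → monomial ℝ e y)
      ≡⟨ ∫-affineFactor (b zero) (u zero) (v zero) _ y ⟩
    affine (b zero) (u zero) (v zero) (y zero) * ∫ (affineProduct (tail b) (tail u) (tail v)) (λ e → monomial ℝ e (tail y))
      ≡⟨ cong (affine (b zero) (u zero) (v zero) (y zero) *_)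
           (trans (sym (eval-∫ (affineProduct (tail b) (tail u) (tail v)) (tail y))) (eval-affineProduct (tail b) (tail u) (tail v) (tail y))) ⟩
    ∏ (λ i → affine (b i) (u i) (v i) (y i)) ∎
    where open ≡-Reasoning

  shift-exponents : ∀ {k} c a (q : Poly ℝ k) (bound : Fin (suc k) → ℕ) → a ≤ℕ bound zero →
                    (∀ {w e} → (w , e) ∈ q → ∀ i → e i ≤ℕ bound (suc i)) →
                    ∀ {w e} → (w , e) ∈ shift c a q → ∀ i → e i ≤ℕ bound i
  shift-exponents c a q bound a≤ q≤ we∈ with ∈-shift⁻ c a q we∈
  ... | e′ , (_ , we′∈q) , refl = λ { zero → a≤ ; (suc i) → q≤ we′∈q i }

  indicator-bound : ∀ {k} (g : Fin k → ℕ) c (b : Fin k → Bool) → (∀ i → b i ≡ true → c ≤ℕ g i) →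
                    degree (indicator b) *ℕ c ≤ℕ sumFin ℝ g
  indicator-bound {zero} g c b _ = z≤n
  indicator-bound {suc k} g c b c≤g with b zero in b₀≡
  ... | true = ℕ.+-mono-≤ (c≤g zero b₀≡) (indicator-bound (tail g) c (tail b) (c≤g ∘ suc))
  ... | false = ℕ.≤-trans (indicator-bound (tail g) c (tail b) (c≤g ∘ suc)) (ℕ.m≤n+m _ (g zero))

  affineProduct-exponents : ∀ {k} b u v {w e} → (w , e) ∈ affineProduct {k} b u v → ∀ i → e i ≤ℕ indicator b i
  affineProduct-exponents {zero} b u v (here refl) ()
  affineProduct-exponents {suc k} b u v we∈ with b zero in b₀≡
  ... | true = [ shift-exponents (u zero) 0 _ (indicator b) z≤n (affineProduct-exponents (tail b) (tail u) (tail v))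
              , shift-exponents (v zero) 1 _ (indicator b) (subst (λ β → 1 ≤ℕ (if β then 1 else 0)) (sym b₀≡) ℕ.≤-refl)
                  (affineProduct-exponents (tail b) (tail u) (tail v)) ]′
              (∈-++⁻ (shift (u zero) 0 (affineProduct (tail b) (tail u) (tail v))) we∈)
  ... | false = shift-exponents (u zero) 0 _ (indicator b) z≤n (affineProduct-exponents (tail b) (tail u) (tail v)) we∈

module FiniteDomains where

  signVectors : ∀ k → List (Fin k → Sign)
  signVectors zero = (λ ()) ∷ []
  signVectors (suc k) = concatMap (λ s → map (s ◂_) (signVectors k)) (Sign.+ ∷ Sign.- ∷ [])

  signVectors-complete : ∀ k (z : Fin k → Sign) → Σ (Fin k → Sign) λ z′ → z′ ∈ signVectors k × (∀ i → z i ≡ z′ i)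
  signVectors-complete zero z = (λ ()) , here refl , λ ()
  signVectors-complete (suc k) z with signVectors-complete k (tail z)
  ... | z′ , z′∈ , tail≗ = z zero ◂ z′ , ∈-concatMap⁺ (λ s → map (s ◂_) (signVectors k)) (lose (first-sign∈ (z zero)) (∈-map⁺ (z zero ◂_) z′∈)) ,
                          λ { zero → refl ; (suc i) → tail≗ i }
    where
    first-sign∈ : ∀ s → s ∈ Sign.+ ∷ Sign.- ∷ []
    first-sign∈ Sign.+ = here refl
    first-sign∈ Sign.- = there (here refl)

  elements : ∀ {A : Set} (X : List A) → List (Σ A λ x → x ∈ X)
  elements [] = []
  elements (x ∷ X) = (x , here refl) ∷ map (λ (y , y∈X) → y , there y∈X) (elements X)

  elements-complete : ∀ {A : Set} (X : List A) t → t ∈ elements X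
  elements-complete (x ∷ X) (x , here refl) = here refl
  elements-complete (x ∷ X) (y , there y∈X) = there (∈-map⁺ (λ (y , y∈X) → y , there y∈X) (elements-complete X (y , y∈X)))

-- Let ψF be
-- a dual witness of degree dF for F on the cube and ψf one of degree df for
-- f on X, and write ψf_s for the restriction of ψf to f = s.  Then
--   Ψ(x₁,…,xₖ) = Σ_z ψF(z) ∏ᵢ ψf_{zᵢ}(xᵢ)
-- is a dual witness of degree df + dF (df + 1) = (dF + 1)(df + 1) - 1 for
-- F(f,…,f).  For a monomial e split into blocks eᵢ, integrating against Ψ
-- gives Σ_z ψF(z) F(z) ∏ᵢ Aᵢ(zᵢ) with Aᵢ(s) = ∫ ψf_s x^{eᵢ}.  Blocks of
-- degree ≤ df have Aᵢ(+) = Aᵢ(-), so ∏ᵢ Aᵢ(zᵢ) is a polynomial in z of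
-- degree at most the number of heavier blocks, which is ≤ dF; hence ψF
-- annihilates it.
module Composition (ℝ : RealField) where
  open OrderedField ℝ
  open Measures ℝ
  open Polynomials ℝ
  open SignRepDuality ℝ
  open ProductMeasure ℝ
  open Blocks ℝ
  open AffineProduct ℝ

  module Witness {n k : ℕ} (X : List (Fin n → R)) (f : (Fin n → R) → Sign) (F : (Fin k → Sign) → Sign)
                 (F-pointwise : ∀ z z′ → (∀ i → z i ≡ z′ i) → F z ≡ F z′)
                 (dF df : ℕ)
                 (ψF : Measure (Fin k → Sign)) (ψF-witness : DualWitness (cubeι ℝ) F dF ψF)
                 (ψf : Measure (Elem ℝ X)) (ψf-witness : DualWitness proj₁ (f ∘ proj₁) df ψf) where

    f̂ : Elem ℝ X → Sign
    f̂ x = f (proj₁ x)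

    ψf± : Sign → Measure (Elem ℝ X)
    ψf± s = restrict f̂ s ψf

    -- Orthogonality to the constant monomial balances the two restrictions,
    -- so each carries half of the positive total mass.
    restrictions-positive : ∀ s → HasPositiveAtom (ψf± s)
    restrictions-positive s = positive-mass⇒atom (ψf± s) (mass-pos s)
      where
      ψf⊥ : Orthogonal proj₁ f̂ df ψf
      ψf⊥ = proj₂ (proj₂ ψf-witness)
      P M : R
      P = ∫ (ψf± Sign.+) (λ _ → 1r)
      M = ∫ (ψf± Sign.-) (λ _ → 1r)
      balanced : P ≡ M
      balanced = x-y≡0⇒x≡y P M (begin
        P + - M
          ≡⟨ sym (∫-signed f̂ ψf (λ _ → 1r)) ⟩
        ∫ ψf (λ x → toR ℝ (f̂ x) * 1r)
          ≡⟨ ∫-cong ψf (λ {_} {x} _ → cong (toR ℝ (f̂ x) *_) (sym (monomial-1 (proj₁ x)))) ⟩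
        ∫ ψf (λ x → toR ℝ (f̂ x) * monomial ℝ (λ _ → 0) (proj₁ x))
          ≡⟨ ψf⊥ (λ _ → 0) (subst (_≤ℕ df) (sym (degree-1 n)) z≤n) ⟩
        0r ∎)
        where open ≡-Reasoning
      total-pos : 0r < P + M
      total-pos = let (w , t , wt∈ , 0<w) = proj₁ (proj₂ ψf-witness) in
        subst (0r <_) (∫-restrict f̂ ψf (λ _ → 1r)) (∫-pos ψf (proj₁ ψf-witness) (λ _ → inj₁ 0<1) wt∈ 0<w 0<1)
      mass-pos : ∀ s → 0r < ∫ (ψf± s) (λ _ → 1r)
      mass-pos Sign.+ = 0<x+x⇒0<x (subst (λ y → 0r < P + y) (sym balanced) total-pos)
      mass-pos Sign.- = 0<x+x⇒0<x (subst (λ y → 0r < y + M) balanced total-pos)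

    Ψ : Measure (Fin k → Elem ℝ X)
    Ψ = bind ψF (λ z → product (λ i → ψf± (z i)))

    Ψ-nonneg : NonNegative Ψ
    Ψ-nonneg us∈ with ∈-bind⁻ ψF _ us∈
    ... | w , z , v , wz∈ψF , vs∈ , refl = nn*nn (proj₁ ψF-witness wz∈ψF)
          (product-nonneg (λ i → ψf± (z i)) (λ i → restrict-nonneg f̂ (z i) ψf (proj₁ ψf-witness)) vs∈)

    Ψ-positive : HasPositiveAtom Ψ
    Ψ-positive =
      let (w , z , wz∈ψF , 0<w) = proj₁ (proj₂ ψF-witness)
          (v , xs , vxs∈ , 0<v) = product-positive (λ i → ψf± (z i)) (λ i → restrictions-positive (z i))
      in w * v , xs , ∈-bind⁺ ψF _ wz∈ψF vxs∈ , *-pos w v 0<w 0<v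

    module Orthogonality (e : Fin (k *ℕ n) → ℕ) (deg≤ : degree e ≤ℕ df +ℕ dF *ℕ suc df) where

      A : Fin k → Sign → R
      A i s = ∫ (ψf± s) (λ x → monomial ℝ (block {k} {n} e i) (proj₁ x))

      heavy : Fin k → Bool
      heavy i = isYes (suc df ℕ.≤? degree (block {k} {n} e i))

      heavy-degree : ∀ i → heavy i ≡ true → suc df ≤ℕ degree (block {k} {n} e i)
      heavy-degree i _ with suc df ℕ.≤? degree (block {k} {n} e i)
      heavy-degree i _ | yes df<deg = df<deg

      light-balanced : ∀ i → heavy i ≡ false → A i Sign.+ ≡ A i Sign.-
      light-balanced i _ with suc df ℕ.≤? degree (block {k} {n} e i)
      light-balanced i _ | no df≮deg = x-y≡0⇒x≡y _ _
        (trans (sym (∫-signed f̂ ψf _)) (proj₂ (proj₂ ψf-witness) (block {k} {n} e i) (ℕ.≤-pred (ℕ.≰⇒> df≮deg))))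

      -- More than dF heavy blocks would give e degree ≥ (dF + 1)(df + 1).
      few-heavy : degree (indicator heavy) ≤ℕ dF
      few-heavy with degree (indicator heavy) ℕ.≤? dF
      ... | yes few = few
      ... | no many = ⊥-elim (ℕ.<-irrefl refl (ℕ.≤-trans (ℕ.*-monoˡ-≤ (suc df) (ℕ.≰⇒> many))
              (ℕ.≤-trans (indicator-bound _ (suc df) heavy heavy-degree)
                (ℕ.≤-trans (ℕ.≤-reflexive (sym (degree-blocks {k} {n} e))) deg≤))))

      -- The coefficients making affine (heavy i) (u i) (v i) interpolate A i on {-1, 1}.
      u v : Fin k → R
      u i = half * (A i Sign.+ + A i Sign.-)
      v i = half * (A i Sign.+ + - A i Sign.-)

      affine-on-sign : ∀ i s → affine (heavy i) (u i) (v i) (toR ℝ s) ≡ A i s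
      affine-on-sign i s with heavy i in heavy≡
      affine-on-sign i Sign.+ | true =
        trans (cong (u i +_) (*-idʳ (v i))) (half-sum+half-diff (A i Sign.+) (A i Sign.-))
      affine-on-sign i Sign.- | true =
        trans (cong (u i +_) (trans (sym (-‿distribʳ-* (v i) 1r)) (cong -_ (*-idʳ (v i)))))
              (half-sum-half-diff (A i Sign.+) (A i Sign.-))
      affine-on-sign i Sign.+ | false =
        trans (cong (λ m → half * (A i Sign.+ + m)) (sym (light-balanced i heavy≡))) (half-double _)
      affine-on-sign i Sign.- | false =
        trans (cong (λ p → half * (p + A i Sign.-)) (light-balanced i heavy≡)) (half-double _)

      Q : Poly ℝ k
      Q = affineProduct heavy u v

      Q-on-cube : ∀ z → eval ℝ Q (cubeι ℝ z) ≡ ∏ (λ i → A i (z i))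
      Q-on-cube z = trans (eval-affineProduct heavy u v _) (∏-cong (λ i → affine-on-sign i (z i)))

      -- Integrating against the z-th product measure: F(f, …, f) equals F z
      -- on its support, and the monomial factors over the blocks.
      inner : ∀ z → ∫ (product (λ i → ψf± (z i))) (λ xs → toR ℝ (compose ℝ F f xs) * monomial ℝ e (flatten ℝ xs))
                    ≡ toR ℝ (F z) * ∏ (λ i → A i (z i))
      inner z = begin
        ∫ (product μs) (λ xs → toR ℝ (compose ℝ F f xs) * monomial ℝ e (flatten ℝ xs))
          ≡⟨ ∫-cong (product μs) (λ {_} {xs} wxs∈ → cong₂ _*_
               (cong (toR ℝ) (F-pointwise _ z (λ i → on-support wxs∈ i))) (monomial-flatten e xs)) ⟩
        ∫ (product μs) (λ xs → toR ℝ (F z) * ∏ (λ i → monomial ℝ (block {k} {n} e i) (proj₁ (xs i))))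
          ≡⟨ ∫-* (product μs) (toR ℝ (F z)) _ ⟩
        toR ℝ (F z) * ∫ (product μs) (λ xs → ∏ (λ i → monomial ℝ (block {k} {n} e i) (proj₁ (xs i))))
          ≡⟨ cong (toR ℝ (F z) *_) (∫-product μs (λ i x → monomial ℝ (block {k} {n} e i) (proj₁ x))) ⟩
        toR ℝ (F z) * ∏ (λ i → A i (z i)) ∎
        where
        open ≡-Reasoning
        μs : Fin k → Measure (Elem ℝ X)
        μs i = ψf± (z i)
        on-support : ∀ {w xs} → (w , xs) ∈ product μs → ∀ i → f̂ (xs i) ≡ z i
        on-support wxs∈ i = let (wᵢ , xᵢ∈) = product-points μs wxs∈ i in proj₂ (∈-restrict⁻ f̂ (z i) ψf xᵢ∈)

      orthogonal : ∫ Ψ (λ xs → toR ℝ (compose ℝ F f xs) * monomial ℝ e (flatten ℝ xs)) ≡ 0r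
      orthogonal = begin
        ∫ Ψ (λ xs → toR ℝ (compose ℝ F f xs) * monomial ℝ e (flatten ℝ xs))
          ≡⟨ ∫-bind ψF _ _ ⟩
        ∫ ψF (λ z → ∫ (product (λ i → ψf± (z i))) (λ xs → toR ℝ (compose ℝ F f xs) * monomial ℝ e (flatten ℝ xs)))
          ≡⟨ ∫-cong ψF (λ {_} {z} _ → trans (inner z) (cong (toR ℝ (F z) *_) (sym (Q-on-cube z)))) ⟩
        ∫ ψF (λ z → toR ℝ (F z) * eval ℝ Q (cubeι ℝ z))
          ≡⟨ orthogonal-poly (cubeι ℝ) F dF ψF (proj₂ (proj₂ ψF-witness)) Q
               (All.tabulate (λ we∈ → ℕ.≤-trans (degree-mono (affineProduct-exponents heavy u v we∈)) few-heavy)) ⟩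
        0r ∎
        where open ≡-Reasoning

    composed-witness : DualWitness (flatten ℝ {k} {n} {X}) (compose ℝ F f) (df +ℕ dF *ℕ suc df) Ψ
    composed-witness = Ψ-nonneg , Ψ-positive , Orthogonality.orthogonal

-- The statement uses the notation of Data.Nat; it is opened only here since
-- _*_ would clash with the field multiplication in the modules above.
open import Data.Nat using (_*_; _≤_)

-- If both threshold
-- degrees are positive and the bound failed, the dual witnesses of degrees
-- deg±(F) - 1 and deg±(f) - 1 would compose to a dual witness for F(f, …, f)
-- of degree deg±(F) deg±(f) - 1 ≥ d, ruling out its sign representation of
-- degree d.
theorem1p1 : (ℝ : RealField) → (n k : ℕ) → (X : List (Fin n → RealField.R ℝ)) →
    (f : (Fin n → RealField.R ℝ) → Sign) → (F : (Fin k → Sign) → Sign) →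
    (dF df d : ℕ) →
    IsThrDeg ℝ (cubeι ℝ) F dF →
    IsThrDeg ℝ (λ (x : Elem ℝ X) → proj₁ x) (λ x → f (proj₁ x)) df →
    IsThrDeg ℝ (flatten ℝ {k} {n} {X}) (compose ℝ {k} {n} {X} F f) d →
    dF * df ≤ d
theorem1p1 ℝ n k X f F zero df d _ _ _ = z≤n
theorem1p1 ℝ n k X f F (suc dF) zero d _ _ _ = subst (_≤ d) (sym (ℕ.*-zeroʳ (suc dF))) z≤n
theorem1p1 ℝ n k X f F (suc dF) (suc df) d thrF thrf thrC with suc dF * suc df ℕ.≤? d
... | yes bound = bound
... | no ¬bound = ⊥-elim (witness⇒¬SignRep (flatten ℝ) (compose ℝ F f) _ Ψ composed-witness
                            (ℕ.≤-pred (ℕ.≰⇒> ¬bound)) (proj₁ thrC))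
  where
  open Measures ℝ using (Measure)
  open SignRepDuality ℝ
  open FiniteDomains
  F-pointwise : ∀ z z′ → (∀ i → z i ≡ z′ i) → F z ≡ F z′
  F-pointwise z z′ z≗z′ = SignRep⇒determined (cubeι ℝ) F (suc dF) (proj₁ thrF) z z′ (λ i → cong (toR ℝ) (z≗z′ i))
  cube-cover : ∀ z → Σ (Fin k → Sign) λ z′ → z′ ∈ signVectors k × F z ≡ F z′ × (∀ i → toR ℝ (z i) ≡ toR ℝ (z′ i))
  cube-cover z = let (z′ , z′∈ , z≗z′) = signVectors-complete k z
                 in z′ , z′∈ , F-pointwise z z′ z≗z′ , λ i → cong (toR ℝ) (z≗z′ i)
  ψF : Σ (Measure (Fin k → Sign)) (DualWitness (cubeι ℝ) F dF)
  ψF = threshold⇒witness (cubeι ℝ) F dF (signVectors k) cube-cover thrF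
  ψf : Σ (Measure (Elem ℝ X)) (DualWitness proj₁ (f ∘ proj₁) df)
  ψf = threshold⇒witness proj₁ (f ∘ proj₁) df (elements X) (λ x → x , elements-complete X x , refl , λ _ → refl) thrf
  open Composition.Witness ℝ X f F F-pointwise dF df (proj₁ ψF) (proj₂ ψF) (proj₁ ψf) (proj₂ ψf)
    using (Ψ; composed-witness)
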